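{- For every tree $T$ of order $n$, $\sigma_t(T)\le (n-2)\,\sigma(T)$. Equality holds only when $T=P_n$ (the path on $n$ vertices).
   Context: For a graph $G=(V,E)$, $d(u)$ denotes the degree of a vertex $u$. Define $\sigma(G)=\sum_{uv\in E(G)}(d(u)-d(v))^2$ (sum over edges) and $\sigma_t(G)=\sum_{\{u,v\}\subseteq V(G)}(d(u)-d(v))^2$ (sum over all unordered pairs of distinct vertices). -}

module Defs where

open import Data.Bool using (Bool; true; false; if_then_else_; _∧_)
open import Data.Nat using (ℕ; zero; suc; _+_; _*_; _∸_; _^_; _≤_; _<ᵇ_; ∣_-_∣)
open import Data.Fin using (Fin; toℕ)
open import Data.List using (List; []; _∷_; map; allFin; length; last)
open import Data.Nat.ListAction using (sum)
open import Data.Nat.Properties using (∣-∣-comm; ∣n-n∣≡0)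
open import Relation.Binary.PropositionalEquality using (cong)
open import Function.Bundles using (Inverse)
open import Data.List.Relation.Unary.Unique.Propositional using (Unique)
open import Data.Maybe using (Maybe; just; nothing)
open import Data.Product using (Σ; ∃; _×_; _,_)
open import Relation.Binary.PropositionalEquality using (_≡_)
open import Relation.Nullary using (¬_)
open import Function.Bundles using (_↔_)

record Graph (n : ℕ) : Set where
  field
    adj    : Fin n → Fin n → Bool
    sym    : ∀ u v → adj u v ≡ adj v u
    irrefl : ∀ u → adj u u ≡ false
open Graph public

deg : ∀ {n} → Graph n → Fin n → ℕ
deg {n} G u = sum (map (λ v → if adj G u v then 1 else 0) (allFin n))

-- sum of f over all unordered pairs {u,v} of distinct vertices (taken as u < v)
sumPairs : ∀ n → (Fin n → Fin n → ℕ) → ℕ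
sumPairs n f = sum (map (λ u → sum (map (λ v → if toℕ u <ᵇ toℕ v then f u v else 0) (allFin n))) (allFin n))

sqDiff : ∀ {n} → Graph n → Fin n → Fin n → ℕ
sqDiff G u v = ∣ deg G u - deg G v ∣ ^ 2

σ : ∀ {n} → Graph n → ℕ
σ {n} G = sumPairs n (λ u v → if adj G u v then sqDiff G u v else 0)

σt : ∀ {n} → Graph n → ℕ
σt {n} G = sumPairs n (sqDiff G)

data Walk {n} (G : Graph n) : Fin n → Fin n → Set where
  here : ∀ {u} → Walk G u u
  step : ∀ {u v w} → adj G u v ≡ true → Walk G v w → Walk G u w

Connected : ∀ {n} → Graph n → Set
Connected G = ∀ u v → Walk G u v

data Chain {n} (G : Graph n) : List (Fin n) → Set where
  nil  : Chain G []
  one  : ∀ {u} → Chain G (u ∷ [])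
  cons : ∀ {u v vs} → adj G u v ≡ true → Chain G (v ∷ vs) → Chain G (u ∷ v ∷ vs)

IsCycle : ∀ {n} → Graph n → List (Fin n) → Set
IsCycle G [] = Data.Empty.⊥ where import Data.Empty
IsCycle G (v₀ ∷ vs) =
  (3 ≤ length (v₀ ∷ vs)) × Unique (v₀ ∷ vs) × Chain G (v₀ ∷ vs) ×
  (∃ λ w → last (v₀ ∷ vs) ≡ just w × adj G w v₀ ≡ true)

Acyclic : ∀ {n} → Graph n → Set
Acyclic G = ∀ cs → ¬ IsCycle G cs

IsTree : ∀ {n} → Graph n → Set
IsTree G = Connected G × Acyclic G

isOne : ℕ → Bool
isOne 1 = true
isOne _ = false

pathAdj : ∀ n → Fin n → Fin n → Bool
pathAdj n i j = isOne ∣ toℕ i - toℕ j ∣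

P : ∀ n → Graph n
P n = record
  { adj    = pathAdj n
  ; sym    = λ i j → cong isOne (∣-∣-comm (toℕ i) (toℕ j))
  ; irrefl = λ i → cong isOne (∣n-n∣≡0 (toℕ i))
  }

_≅_ : ∀ {n} → Graph n → Graph n → Set
_≅_ {n} G H = Σ (Fin n ↔ Fin n) λ f →
  ∀ u v → adj G u v ≡ adj H (Inverse.to f u) (Inverse.to f v)

-- Root the tree T at a vertex r of maximum degree, write p u for the parent of u ≠ r and
-- x u = d(u) - 1 (excess u). Every edge joins a vertex to its parent, so σ = Σ_{u ≠ r} δ u² with
-- δ u = x u - x (p u); and σ_t = n Σ x² - (Σ x)² with Σ x = n - 2. With m = x r a direct
-- computation gives
--   (n - 2) σ - σ_t = (n - 2) E + 2 W,   E = Σ_{u ≠ r} (δ u² + δ u),   W = Σ_u x u (m - x u),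
-- and E, W ≥ 0 since δ² + δ ≥ 0 for integers and 0 ≤ x u ≤ m.
-- If equality holds then W = 0, and also E = 0 unless n = 2 (where Σ x = 0 gives m = 0 directly).
-- At a deepest vertex w, a leaf, E = 0 forces x (p w) ∈ {0, 1}, and with W = 0 either case gives
-- m ≤ 1: T has maximum degree 2. Rooted at a leaf, such a tree has exactly one vertex at each
-- depth, and numbering vertices by depth is an isomorphism onto P_n.

module Submission where

open import Defs hiding (sym)
open import Data.Nat using (ℕ; zero; suc)
open import Data.Fin using (Fin; zero; suc)
open import Relation.Binary.PropositionalEquality using (_≡_; _≢_)

module IntegerSums where

  import Data.Nat as ℕ
  import Data.Nat.ListAction as ℕ
  open import Data.Nat using (z≤n)
  open import Data.Nat.Properties
    using (<ᵇ-reflects-<; <-asym; ≮⇒≥; ≤-antisym; ≤-total; *-identityʳ; ∣-∣-comm; m≤n⇒∣m-n∣≡n∸m)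
  open import Data.Integer using (ℤ; +_; -[1+_]; 0ℤ; 1ℤ; _+_; _-_; -_; _*_; _≤_; +≤+; ∣_∣; _⊖_)
  import Data.Integer.Properties as ℤ
  open import Data.Integer.Tactic.RingSolver using (solve-∀)
  open import Data.Fin using (toℕ)
  open import Data.Fin.Properties using (_≟_; toℕ-injective)
  open import Data.List using (map; allFin; tabulate)
  open import Data.List.Properties using (map-tabulate)
  open import Data.Bool using (true; false; if_then_else_)
  open import Data.Empty using (⊥-elim)
  open import Data.Product using (_×_; _,_)
  open import Data.Sum using (inj₁; inj₂)
  open import Function using (_∘_; id)
  open import Relation.Nullary using (Dec; yes; no; ¬_; does; contradiction)
  open import Relation.Nullary.Reflects using (ofʸ; ofⁿ)
  open import Relation.Binary.PropositionalEquality using (refl; sym; trans; cong; cong₂; subst; module ≡-Reasoning)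

  open import Algebra.Properties.Semiring.Sum ℤ.+-*-semiring public
    using (sum; sum-syntax; sum-cong-≗; ∑-distrib-+; ∑-comm; *-distribˡ-sum; *-distribʳ-sum)

  𝟙 : ∀ {p} {P : Set p} → Dec P → ℤ
  𝟙 d = if does d then 1ℤ else 0ℤ

  𝟙-yes : ∀ {p} {P : Set p} (d : Dec P) → P → 𝟙 d ≡ 1ℤ
  𝟙-yes (yes _) _ = refl
  𝟙-yes (no ¬p) p = contradiction p ¬p

  𝟙-no : ∀ {p} {P : Set p} (d : Dec P) → ¬ P → 𝟙 d ≡ 0ℤ
  𝟙-no (yes p) ¬p = contradiction p ¬p
  𝟙-no (no _) _ = refl

  ∑-distrib-- : ∀ {n} (f g : Fin n → ℤ) → ∑[ i < n ] (f i - g i) ≡ ∑[ i < n ] f i - ∑[ i < n ] g i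
  ∑-distrib-- {zero} f g = refl
  ∑-distrib-- {suc n} f g = trans (cong (λ s → f zero - g zero + s) (∑-distrib-- (f ∘ suc) (g ∘ suc)))
                                  (swap (f zero) (g zero) (∑[ i < n ] f (suc i)) (∑[ i < n ] g (suc i)))
    where
    swap : ∀ a b c d → a - b + (c - d) ≡ a + c - (b + d)
    swap = solve-∀

  ∑-const : ∀ n c → ∑[ i < n ] c ≡ + n * c
  ∑-const zero c = sym (ℤ.*-zeroˡ c)
  ∑-const (suc n) c = trans (cong (λ s → c + s) (∑-const n c)) (sym (ℤ.suc-* (+ n) c))

  ∑-zero : ∀ n → ∑[ i < n ] 0ℤ ≡ 0ℤ
  ∑-zero n = trans (∑-const n 0ℤ) (ℤ.*-zeroʳ (+ n))

  ∑-pick : ∀ {n} (w : Fin n) (g : Fin n → ℤ) → ∑[ v < n ] (𝟙 (v ≟ w) * g v) ≡ g w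
  ∑-pick {suc n} zero g = begin
    1ℤ * g zero + ∑[ v < n ] (0ℤ * g (suc v))
      ≡⟨ cong₂ _+_ (ℤ.*-identityˡ (g zero)) (sum-cong-≗ (λ v → ℤ.*-zeroˡ (g (suc v)))) ⟩
    g zero + ∑[ v < n ] 0ℤ                     ≡⟨ cong (λ s → g zero + s) (∑-zero n) ⟩
    g zero + 0ℤ                                ≡⟨ ℤ.+-identityʳ (g zero) ⟩
    g zero                                     ∎
    where open ≡-Reasoning
  ∑-pick {suc n} (suc w) g = trans (ℤ.+-identityˡ _) (∑-pick w (g ∘ suc))

  ∑-nonneg : ∀ {n} {f : Fin n → ℤ} → (∀ i → 0ℤ ≤ f i) → 0ℤ ≤ ∑[ i < n ] f i
  ∑-nonneg {zero} f≥0 = ℤ.≤-refl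
  ∑-nonneg {suc n} f≥0 = ℤ.+-mono-≤ (f≥0 zero) (∑-nonneg (f≥0 ∘ suc))

  private
    ≤+nonneg : ∀ {a b} → 0ℤ ≤ b → a ≤ a + b
    ≤+nonneg {a} b≥0 = ℤ.≤-trans (ℤ.≤-reflexive (sym (ℤ.+-identityʳ a))) (ℤ.+-monoʳ-≤ a b≥0)

    ≤nonneg+ : ∀ {a b} → 0ℤ ≤ a → b ≤ a + b
    ≤nonneg+ {a} {b} a≥0 = ℤ.≤-trans (≤+nonneg a≥0) (ℤ.≤-reflexive (ℤ.+-comm b a))

  𝟙-nonneg : ∀ {p} {P : Set p} (d : Dec P) → 0ℤ ≤ 𝟙 d
  𝟙-nonneg (yes _) = +≤+ z≤n
  𝟙-nonneg (no _) = +≤+ z≤n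

  *-nonneg : ∀ {a b} → 0ℤ ≤ a → 0ℤ ≤ b → 0ℤ ≤ a * b
  *-nonneg {+ a} {+ b} (+≤+ _) (+≤+ _) = subst (0ℤ ≤_) (ℤ.pos-* a b) (+≤+ z≤n)

  square+self-nonneg : ∀ a → 0ℤ ≤ a * a + a
  square+self-nonneg (+ k) = ℤ.+-mono-≤ (*-nonneg (+≤+ {n = k} z≤n) (+≤+ {n = k} z≤n)) (+≤+ {n = k} z≤n)
  square+self-nonneg -[1+ k ] = subst (0ℤ ≤_) (sym (factor (+ k))) (*-nonneg (+≤+ {n = k} z≤n) (+≤+ {n = suc k} z≤n))
    where
    factor : ∀ j → (- (1ℤ + j)) * (- (1ℤ + j)) + (- (1ℤ + j)) ≡ j * (1ℤ + j)
    factor = solve-∀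

  term≤∑ : ∀ {n} {f : Fin n → ℤ} → (∀ i → 0ℤ ≤ f i) → ∀ i → f i ≤ ∑[ j < n ] f j
  term≤∑ f≥0 zero = ≤+nonneg (∑-nonneg (f≥0 ∘ suc))
  term≤∑ f≥0 (suc i) = ℤ.≤-trans (term≤∑ (f≥0 ∘ suc) i) (≤nonneg+ (f≥0 zero))

  two-terms≤∑ : ∀ {n} {f : Fin n → ℤ} → (∀ i → 0ℤ ≤ f i) → ∀ {i j} → i ≢ j → f i + f j ≤ ∑[ k < n ] f k
  two-terms≤∑ f≥0 {zero} {zero} i≢j = contradiction refl i≢j
  two-terms≤∑ {f = f} f≥0 {zero} {suc j} _ = ℤ.+-monoʳ-≤ (f zero) (term≤∑ (f≥0 ∘ suc) j)
  two-terms≤∑ {f = f} f≥0 {suc i} {zero} _ =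
    ℤ.≤-trans (ℤ.≤-reflexive (ℤ.+-comm (f (suc i)) (f zero))) (ℤ.+-monoʳ-≤ (f zero) (term≤∑ (f≥0 ∘ suc) i))
  two-terms≤∑ f≥0 {suc i} {suc j} i≢j =
    ℤ.≤-trans (two-terms≤∑ (f≥0 ∘ suc) (i≢j ∘ cong suc)) (≤nonneg+ (f≥0 zero))

  ∑≡0⇒≡0 : ∀ {n} {f : Fin n → ℤ} → (∀ i → 0ℤ ≤ f i) → ∑[ i < n ] f i ≡ 0ℤ → ∀ i → f i ≡ 0ℤ
  ∑≡0⇒≡0 f≥0 ∑≡0 i = ℤ.≤-antisym (ℤ.≤-trans (term≤∑ f≥0 i) (ℤ.≤-reflexive ∑≡0)) (f≥0 i)

  +-nonneg-≡0 : ∀ {a b} → 0ℤ ≤ a → 0ℤ ≤ b → a + b ≡ 0ℤ → a ≡ 0ℤ × b ≡ 0ℤ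
  +-nonneg-≡0 {a} {b} a≥0 b≥0 a+b≡0 = a≡0 , trans (sym (ℤ.+-identityˡ b)) (trans (cong (_+ b) (sym a≡0)) a+b≡0)
    where
    a≡0 : a ≡ 0ℤ
    a≡0 = ℤ.≤-antisym (ℤ.≤-trans (≤+nonneg b≥0) (ℤ.≤-reflexive a+b≡0)) a≥0

  +sum-tabulate : ∀ {n} (g : Fin n → ℕ) → + ℕ.sum (tabulate g) ≡ ∑[ i < n ] (+ g i)
  +sum-tabulate {zero} g = refl
  +sum-tabulate {suc n} g = trans (ℤ.pos-+ (g zero) _) (cong (λ s → + g zero + s) (+sum-tabulate (g ∘ suc)))

  +sum-allFin : ∀ {n} (g : Fin n → ℕ) → + ℕ.sum (map g (allFin n)) ≡ ∑[ i < n ] (+ g i)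
  +sum-allFin g = trans (cong (λ xs → + ℕ.sum xs) (map-tabulate id g)) (+sum-tabulate g)

  2*sumPairs≡∑∑ : ∀ n (f : Fin n → Fin n → ℕ) → (∀ u v → f u v ≡ f v u) → (∀ u → f u u ≡ 0) →
              + 2 * + sumPairs n f ≡ ∑[ u < n ] ∑[ v < n ] (+ f u v)
  2*sumPairs≡∑∑ n f f-sym f-diag = begin
    + 2 * + sumPairs n f                    ≡⟨ twice (+ sumPairs n f) ⟩
    + sumPairs n f + + sumPairs n f         ≡⟨ cong₂ _+_ below (trans below (∑-comm A)) ⟩
    ∑[ u < n ] ∑[ v < n ] A u v + ∑[ u < n ] ∑[ v < n ] A v u
      ≡⟨ sym (∑-distrib-+ (λ u → ∑[ v < n ] A u v) (λ u → ∑[ v < n ] A v u)) ⟩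
    ∑[ u < n ] (∑[ v < n ] A u v + ∑[ v < n ] A v u)
      ≡⟨ sum-cong-≗ (λ u → sym (∑-distrib-+ (A u) (λ v → A v u))) ⟩
    ∑[ u < n ] ∑[ v < n ] (A u v + A v u)   ≡⟨ sum-cong-≗ (λ u → sum-cong-≗ (halves u)) ⟩
    ∑[ u < n ] ∑[ v < n ] (+ f u v)           ∎
    where
    open ≡-Reasoning
    A′ : Fin n → Fin n → ℕ
    A′ u v = if toℕ u ℕ.<ᵇ toℕ v then f u v else 0
    A : Fin n → Fin n → ℤ
    A u v = + A′ u v
    twice : ∀ s → + 2 * s ≡ s + s
    twice = solve-∀
    below : + sumPairs n f ≡ ∑[ u < n ] ∑[ v < n ] A u v
    below = trans (+sum-allFin (λ u → ℕ.sum (map (A′ u) (allFin n)))) (sum-cong-≗ (λ u → +sum-allFin (A′ u)))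
    halves : ∀ u v → + (if toℕ u ℕ.<ᵇ toℕ v then f u v else 0) + + (if toℕ v ℕ.<ᵇ toℕ u then f v u else 0) ≡ + f u v
    halves u v with toℕ u ℕ.<ᵇ toℕ v | <ᵇ-reflects-< (toℕ u) (toℕ v) | toℕ v ℕ.<ᵇ toℕ u | <ᵇ-reflects-< (toℕ v) (toℕ u)
    ... | true  | ofʸ u<v | true  | ofʸ v<u = ⊥-elim (<-asym u<v v<u)
    ... | true  | _       | false | _       = ℤ.+-identityʳ _
    ... | false | _       | true  | _       = cong +_ (f-sym v u)
    ... | false | ofⁿ u≮v | false | ofⁿ v≮u with toℕ-injective (≤-antisym (≮⇒≥ v≮u) (≮⇒≥ u≮v))
    ...   | refl = cong +_ (sym (f-diag u))

  ∣-∣≡∣⊖∣ : ∀ a b → ℕ.∣ a - b ∣ ≡ ∣ a ⊖ b ∣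
  ∣-∣≡∣⊖∣ a b with ≤-total a b
  ... | inj₁ a≤b = trans (m≤n⇒∣m-n∣≡n∸m a≤b) (sym (ℤ.∣⊖∣-≤ a≤b))
  ... | inj₂ b≤a = trans (∣-∣-comm a b)
                      (trans (m≤n⇒∣m-n∣≡n∸m b≤a) (sym (trans (ℤ.∣m⊖n∣≡∣n⊖m∣ a b) (ℤ.∣⊖∣-≤ b≤a))))

  +∣m-n∣^2≡[m-n]^2 : ∀ a b → + (ℕ.∣ a - b ∣ ℕ.^ 2) ≡ (+ a - + b) * (+ a - + b)
  +∣m-n∣^2≡[m-n]^2 a b = begin
    + (ℕ.∣ a - b ∣ ℕ.* (ℕ.∣ a - b ∣ ℕ.* 1))  ≡⟨ cong (λ k → + (ℕ.∣ a - b ∣ ℕ.* k)) (*-identityʳ _) ⟩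
    + (ℕ.∣ a - b ∣ ℕ.* ℕ.∣ a - b ∣)          ≡⟨ ℤ.pos-* ℕ.∣ a - b ∣ ℕ.∣ a - b ∣ ⟩
    + ℕ.∣ a - b ∣ * + ℕ.∣ a - b ∣            ≡⟨ cong (λ k → + k * + k) (∣-∣≡∣⊖∣ a b) ⟩
    + ∣ i ∣ * + ∣ i ∣                          ≡⟨ abs² (ℤ.+∣i∣≡i⊎+∣i∣≡-i i) ⟩
    i * i                                      ≡⟨ cong (λ k → k * k) (sym (ℤ.m-n≡m⊖n a b)) ⟩
    (+ a - + b) * (+ a - + b)                  ∎
    where
    open ≡-Reasoning
    i = a ⊖ b
    neg² : ∀ x → (- x) * (- x) ≡ x * x
    neg² = solve-∀
    abs² : _ → + ∣ i ∣ * + ∣ i ∣ ≡ i * i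
    abs² (inj₁ eq) = cong₂ _*_ eq eq
    abs² (inj₂ eq) = trans (cong₂ _*_ eq eq) (neg² i)

  ∑∑-square-differences : ∀ n (f : Fin n → ℤ) →
    ∑[ u < n ] ∑[ v < n ] ((f u - f v) * (f u - f v))
      ≡ + 2 * (+ n * ∑[ u < n ] (f u * f u) - ∑[ u < n ] f u * ∑[ u < n ] f u)
  ∑∑-square-differences n f = begin
    ∑[ u < n ] ∑[ v < n ] ((f u - f v) * (f u - f v))         ≡⟨ sum-cong-≗ (λ u → row (f u)) ⟩
    ∑[ u < n ] (+ n * (f u * f u) + (Q - + 2 * f u * S))      ≡⟨ ∑-distrib-+ (λ u → + n * (f u * f u)) (λ u → Q - + 2 * f u * S) ⟩
    ∑[ u < n ] (+ n * (f u * f u)) + ∑[ u < n ] (Q - + 2 * f u * S)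
      ≡⟨ cong₂ _+_ (sym (*-distribˡ-sum (+ n) (λ u → f u * f u))) (∑-distrib-- (λ _ → Q) (λ u → + 2 * f u * S)) ⟩
    + n * Q + (∑[ u < n ] Q - ∑[ u < n ] (+ 2 * f u * S))
      ≡⟨ cong₂ (λ a b → + n * Q + (a - b)) (∑-const n Q) (sym (*-distribʳ-sum S (λ u → + 2 * f u))) ⟩
    + n * Q + (+ n * Q - ∑[ u < n ] (+ 2 * f u) * S)
      ≡⟨ cong (λ t → + n * Q + (+ n * Q - t * S)) (sym (*-distribˡ-sum (+ 2) f)) ⟩
    + n * Q + (+ n * Q - + 2 * S * S)                          ≡⟨ collect (+ n) Q S ⟩
    + 2 * (+ n * Q - S * S)                                    ∎
    where
    open ≡-Reasoning
    S = ∑[ u < n ] f u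
    Q = ∑[ u < n ] (f u * f u)
    expand : ∀ a b → (a - b) * (a - b) ≡ a * a + (b * b - + 2 * a * b)
    expand = solve-∀
    collect : ∀ m q s → m * q + (m * q - + 2 * s * s) ≡ + 2 * (m * q - s * s)
    collect = solve-∀
    row : ∀ a → ∑[ v < n ] ((a - f v) * (a - f v)) ≡ + n * (a * a) + (Q - + 2 * a * S)
    row a = begin
      ∑[ v < n ] ((a - f v) * (a - f v))                    ≡⟨ sum-cong-≗ (λ v → expand a (f v)) ⟩
      ∑[ v < n ] (a * a + (f v * f v - + 2 * a * f v))      ≡⟨ ∑-distrib-+ (λ _ → a * a) (λ v → f v * f v - + 2 * a * f v) ⟩
      ∑[ v < n ] (a * a) + ∑[ v < n ] (f v * f v - + 2 * a * f v)
        ≡⟨ cong₂ _+_ (∑-const n (a * a)) (∑-distrib-- (λ v → f v * f v) (λ v → + 2 * a * f v)) ⟩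
      + n * (a * a) + (Q - ∑[ v < n ] (+ 2 * a * f v))     ≡⟨ cong (λ t → + n * (a * a) + (Q - t)) (sym (*-distribˡ-sum (+ 2 * a) f)) ⟩
      + n * (a * a) + (Q - + 2 * a * S)                     ∎

module Search where

  open import Data.Nat using (_≤_; _<_; s≤s)
  open import Data.Nat.Properties using (1+n≰n)
  open import Data.Fin using (punchOut)
  open import Data.Fin.Properties using (_≟_; any?; punchOut-injective; injective⇒≤)
  open import Data.List using (allFin)
  open import Data.List.Extrema.Nat using (argmax; f[xs]≤f[argmax])
  open import Data.List.Membership.Propositional.Properties using (∈-allFin)
  open import Data.List.Relation.Unary.All using (lookup)
  open import Data.Product using (∃; _×_; _,_)
  open import Function using (_∘_)
  open import Function.Definitions using (Injective)
  open import Relation.Nullary using (yes; no; ¬_; contradiction)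
  open import Relation.Unary using (Decidable)
  open import Relation.Binary.PropositionalEquality using (sym)

  least : ∀ {p} {P : ℕ → Set p} → Decidable P → ∀ {N} → P N → ∃ λ k → P k × (∀ {j} → j < k → ¬ P j)
  least P? pN with P? 0
  ... | yes p0 = 0 , p0 , λ ()
  least P? {zero} pN | no ¬p0 = contradiction pN ¬p0
  least P? {suc N} pN | no ¬p0 with least (P? ∘ suc) pN
  ... | k , pk , below = suc k , pk , λ { {zero} _ → ¬p0 ; {suc j} (s≤s j<k) → below j<k }

  maximiser : ∀ {n} (f : Fin n → ℕ) → Fin n → ∃ λ w → ∀ u → f u ≤ f w
  maximiser {n} f u₀ = argmax f u₀ (allFin n) , λ u → lookup (f[xs]≤f[argmax] u₀ (allFin n)) (∈-allFin u)

  -- A value missed by an injection Fin (suc n) → Fin (suc n) lets punchOut squeeze it into Fin n.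
  injective⇒surjective : ∀ {n} (f : Fin n → Fin n) → Injective _≡_ _≡_ f → ∀ y → ∃ λ x → f x ≡ y
  injective⇒surjective {suc n} f f-inj y with any? (λ x → f x ≟ y)
  ... | yes hit = hit
  ... | no miss = contradiction (injective⇒≤ squeezed-injective) 1+n≰n
    where
    y≢f : ∀ x → y ≢ f x
    y≢f x y≡fx = miss (x , sym y≡fx)
    squeezed-injective : Injective _≡_ _≡_ (λ x → punchOut (y≢f x))
    squeezed-injective eq = f-inj (punchOut-injective (y≢f _) (y≢f _) eq)

module BreadthFirst {n} (G : Graph n) (connected : Connected G) (r : Fin n) where

  open import Data.Nat using (_≤_; _<_; _∸_)
  open import Data.Nat.Properties
    using (≮⇒≥; n≤0⇒n≡0; 1+n≰n; ≤-antisym; ≤-pred; ∸-cancelˡ-≡; +-comm; ∸-+-assoc)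
  open import Data.Bool using (true)
  import Data.Bool.Properties as Bool
  open import Data.Fin using (toℕ)
  open import Data.Fin.Properties using (_≟_; any?; toℕ-injective; toℕ≤pred[n]; injective⇒≤)
  open import Data.Product using (∃; _×_; _,_; proj₁; proj₂)
  open import Data.Sum using (_⊎_; inj₁; inj₂)
  open import Relation.Nullary using (yes; no; contradiction)
  open import Relation.Nullary.Decidable using (_⊎-dec_; _×-dec_)
  open import Relation.Unary using (Decidable)
  open import Relation.Binary.PropositionalEquality using (refl; sym; trans; cong; subst)
  open Search using (least)

  Near : ℕ → Fin n → Set
  Near zero u = u ≡ r
  Near (suc k) u = Near k u ⊎ ∃ λ v → adj G u v ≡ true × Near k v

  near? : ∀ k → Decidable (Near k)
  near? zero u = u ≟ r
  near? (suc k) u = near? k u ⊎-dec any? (λ v → (adj G u v Bool.≟ true) ×-dec near? k v)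

  walk⇒near : ∀ {u} → Walk G u r → ∃ λ k → Near k u
  walk⇒near here = 0 , refl
  walk⇒near (step {v = v} uv walk) with k , near ← walk⇒near walk = suc k , inj₂ (v , uv , near)

  -- Abstract, so that the search defining depth is never unfolded: only these three facts are used.
  abstract
    depth : Fin n → ℕ
    depth u = proj₁ (least (λ k → near? k u) (proj₂ (walk⇒near (connected u r))))

    near-depth : ∀ u → Near (depth u) u
    near-depth u = proj₁ (proj₂ (least (λ k → near? k u) (proj₂ (walk⇒near (connected u r)))))

    near⇒depth≤ : ∀ {j u} → Near j u → depth u ≤ j
    near⇒depth≤ {j} {u} near = ≮⇒≥ λ j<depth → proj₂ (proj₂ (least (λ k → near? k u) _)) j<depth near

  depth-root : depth r ≡ 0
  depth-root = n≤0⇒n≡0 (near⇒depth≤ {0} refl)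

  depth≡0⇒root : ∀ {u} → depth u ≡ 0 → u ≡ r
  depth≡0⇒root {u} eq = subst (λ k → Near k u) eq (near-depth u)

  depth-adj : ∀ {u v} → adj G u v ≡ true → depth u ≤ suc (depth v)
  depth-adj {v = v} uv = near⇒depth≤ (inj₂ (v , uv , near-depth v))

  descend : ∀ u → u ≢ r → ∃ λ v → adj G u v ≡ true × suc (depth v) ≡ depth u
  descend u u≢r with depth u in d≡ | near-depth u
  ... | zero  | near = contradiction near u≢r
  ... | suc k | inj₁ near-k = contradiction (subst (_≤ k) d≡ (near⇒depth≤ near-k)) 1+n≰n
  ... | suc k | inj₂ (v , uv , near-v) = v , uv , cong suc (≤-antisym (near⇒depth≤ near-v) k≤depth-v)
    where
    k≤depth-v : k ≤ depth v
    k≤depth-v = ≤-pred (subst (_≤ suc (depth v)) d≡ (depth-adj uv))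

  -- parent r = r is a junk value: every use of parent u below is guarded by u ≢ r.
  parent : Fin n → Fin n
  parent u with u ≟ r
  ... | yes _ = r
  ... | no u≢r = proj₁ (descend u u≢r)

  parent-adj : ∀ {u} → u ≢ r → adj G u (parent u) ≡ true
  parent-adj {u} u≢r with u ≟ r
  ... | yes u≡r = contradiction u≡r u≢r
  ... | no u≢r′ = proj₁ (proj₂ (descend u u≢r′))

  depth-parent : ∀ {u} → u ≢ r → suc (depth (parent u)) ≡ depth u
  depth-parent {u} u≢r with u ≟ r
  ... | yes u≡r = contradiction u≡r u≢r
  ... | no u≢r′ = proj₂ (proj₂ (descend u u≢r′))

  depth-parent∸1 : ∀ u → depth (parent u) ≡ depth u ∸ 1
  depth-parent∸1 u with u ≟ r
  ... | yes refl = trans depth-root (cong (_∸ 1) (sym depth-root))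
  ... | no u≢r = cong (_∸ 1) (proj₂ (proj₂ (descend u u≢r)))

  ancestor : ℕ → Fin n → Fin n
  ancestor zero u = u
  ancestor (suc i) u = parent (ancestor i u)

  depth-ancestor : ∀ i u → depth (ancestor i u) ≡ depth u ∸ i
  depth-ancestor zero u = refl
  depth-ancestor (suc i) u = trans (depth-parent∸1 (ancestor i u))
    (trans (cong (_∸ 1) (depth-ancestor i u)) (trans (∸-+-assoc (depth u) i 1) (cong (depth u ∸_) (+-comm i 1))))

  -- The ancestors of u at distances 0, …, depth u are pairwise distinct.
  depth<n : ∀ u → depth u < n
  depth<n u = injective⇒≤ {f = λ i → ancestor (toℕ i) u} λ {i} {j} eq →
    toℕ-injective (∸-cancelˡ-≡ (toℕ≤pred[n] i) (toℕ≤pred[n] j)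
      (trans (sym (depth-ancestor (toℕ i) u)) (trans (cong depth eq) (depth-ancestor (toℕ j) u))))

module RootedTree {n} (T : Graph n) (tree : IsTree T) (r : Fin n) where

  open import Data.Nat using (_≤_; z≤n; s≤s)
  open import Data.Nat.Properties using (≤-refl; ≤-reflexive; ≤-trans; ≤-antisym; n≤1+n; 1+n≰n; 0≢1+n; suc-injective; <-cmp)
  open import Data.Bool using (true)
  open import Data.Fin.Properties using (_≟_)
  open import Data.List using (List; []; _∷_; _∷ʳ_; last; length)
  open import Data.List.Relation.Unary.All using (All; []; _∷_)
  import Data.List.Relation.Unary.All as All
  import Data.List.Relation.Unary.All.Properties as All
  open import Data.List.Relation.Unary.AllPairs using ([]; _∷_)
  open import Data.List.Relation.Unary.Unique.Propositional using (Unique)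
  open import Data.Maybe using (just)
  open import Data.Empty using (⊥; ⊥-elim)
  open import Data.Product using (_×_; _,_; proj₁; proj₂)
  open import Data.Sum using (_⊎_; inj₁; inj₂)
  open import Relation.Nullary using (¬_; yes; no; contradiction)
  open import Relation.Binary.Definitions using (tri<; tri≈; tri>)
  open import Relation.Binary.PropositionalEquality using (refl; sym; trans; cong; subst)
  open import Function using (_∘_)

  open BreadthFirst T (proj₁ tree) r public

  last-∷ʳ : ∀ {a} {A : Set a} (xs : List A) y → last (xs ∷ʳ y) ≡ just y
  last-∷ʳ [] y = refl
  last-∷ʳ (x ∷ []) y = refl
  last-∷ʳ (x ∷ x′ ∷ xs) y = last-∷ʳ (x′ ∷ xs) y

  unique-∷ʳ : ∀ {xs : List (Fin n)} {y} → Unique xs → All (_≢ y) xs → Unique (xs ∷ʳ y)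
  unique-∷ʳ [] [] = [] ∷ []
  unique-∷ʳ (x∉xs ∷ xs!) (x≢y ∷ xs≢y) = All.∷ʳ⁺ x∉xs x≢y ∷ unique-∷ʳ xs! xs≢y

  chain-∷ʳ : ∀ {xs a y} → Chain T xs → last xs ≡ just a → adj T a y ≡ true → Chain T (xs ∷ʳ y)
  chain-∷ʳ one refl ay = cons ay one
  chain-∷ʳ (cons uv chain) eq ay = cons uv (chain-∷ʳ chain eq ay)

  adj-sym : ∀ {u v} → adj T u v ≡ true → adj T v u ≡ true
  adj-sym {u} {v} uv = trans (Graph.sym T v u) uv

  adj⇒≢ : ∀ {u v} → adj T u v ≡ true → u ≢ v
  adj⇒≢ {u} uv refl with () ← trans (sym uv) (Graph.irrefl T u)

  ≢root : ∀ {u k} → depth u ≡ suc k → u ≢ r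
  ≢root du refl = 0≢1+n (trans (sym depth-root) du)

  depth-parent≡ : ∀ {u k} → depth u ≡ suc k → depth (parent u) ≡ k
  depth-parent≡ du = suc-injective (trans (depth-parent (≢root du)) du)

  shallower∉ : ∀ {c k xs} → depth c ≡ k → All (λ v → suc k ≤ depth v) xs → All (c ≢_) xs
  shallower∉ {c} dc = All.map λ { le refl → 1+n≰n (subst (λ d → suc d ≤ depth c) (sym dc) le) }

  record Bridge (k : ℕ) (a b : Fin n) : Set where
    constructor bridge
    field
      rest    : List (Fin n)
      unique  : Unique (b ∷ rest)
      chain   : Chain T (b ∷ rest)
      ends-at : last (b ∷ rest) ≡ just a
      deep    : All (λ v → k ≤ depth v) (b ∷ rest)

  -- Climb from a and b towards the root in lockstep: the path grows by one parent at each end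
  -- until the two parents coincide, and that common parent closes a cycle.
  no-bridge : ∀ k {a b} → a ≢ b → depth a ≡ k → depth b ≡ k → Bridge k a b → ⊥
  no-bridge zero a≢b da db _ = a≢b (trans (depth≡0⇒root da) (sym (depth≡0⇒root db)))
  no-bridge (suc k) {a} {b} a≢b da db (bridge rest unique chain ends deep) with parent a ≟ parent b
  ... | yes pa≡pb =
    proj₂ tree (parent a ∷ b ∷ rest)
      (length≥3 rest ends , shallower∉ (depth-parent≡ da) deep ∷ unique , cons pa-b chain , a , ends , parent-adj (≢root da))
    where
    length≥3 : ∀ rest → last (b ∷ rest) ≡ just a → 3 ≤ length (parent a ∷ b ∷ rest)
    length≥3 [] refl = contradiction refl a≢b
    length≥3 (_ ∷ _) _ = s≤s (s≤s (s≤s z≤n))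
    pa-b : adj T (parent a) b ≡ true
    pa-b = subst (λ c → adj T c b ≡ true) (sym pa≡pb) (adj-sym (parent-adj (≢root db)))
  ... | no pa≢pb = no-bridge k pa≢pb (depth-parent≡ da) (depth-parent≡ db) extended
    where
    extended : Bridge k (parent a) (parent b)
    extended = bridge ((b ∷ rest) ∷ʳ parent a)
      (All.∷ʳ⁺ (shallower∉ (depth-parent≡ db) deep) (pa≢pb ∘ sym)
        ∷ unique-∷ʳ unique (All.map (λ {v} pa≢v → pa≢v ∘ sym) (shallower∉ (depth-parent≡ da) deep)))
      (cons (adj-sym (parent-adj (≢root db))) (chain-∷ʳ chain ends (parent-adj (≢root da))))
      (last-∷ʳ (b ∷ rest) (parent a))
      (≤-reflexive (sym (depth-parent≡ db))
        ∷ All.∷ʳ⁺ (All.map (≤-trans (n≤1+n k)) deep) (≤-reflexive (sym (depth-parent≡ da))))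

  same-depth⇒¬adj : ∀ {u v} → adj T u v ≡ true → depth u ≢ depth v
  same-depth⇒¬adj {u} {v} uv du≡dv = no-bridge (depth u) (adj⇒≢ uv) refl (sym du≡dv)
    (bridge (u ∷ []) ((adj⇒≢ vu ∷ []) ∷ [] ∷ []) (cons vu one) refl (≤-reflexive du≡dv ∷ ≤-refl ∷ []))
    where
    vu = adj-sym uv

  ChildOf : Fin n → Fin n → Set
  ChildOf u v = u ≢ r × parent u ≡ v

  child⇒adj : ∀ {u v} → ChildOf u v → adj T u v ≡ true
  child⇒adj (u≢r , refl) = parent-adj u≢r

  child-asym : ∀ {u v} → ChildOf u v → ¬ ChildOf v u
  child-asym {u} (u≢r , refl) (pu≢r , ppu≡u) = 1+n≰n (≤-trans (n≤1+n _) (≤-reflexive (sym loop)))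
    where
    loop : depth u ≡ suc (suc (depth u))
    loop = trans (sym (depth-parent u≢r)) (cong suc (trans (sym (depth-parent pu≢r)) (cong (suc ∘ depth) ppu≡u)))

  deeper-neighbour⇒child : ∀ {u v} → adj T u v ≡ true → depth v ≡ suc (depth u) → ChildOf v u
  deeper-neighbour⇒child {u} {v} uv dv with parent v ≟ u
  ... | yes pv≡u = ≢root dv , pv≡u
  ... | no pv≢u = ⊥-elim (no-bridge (depth u) (pv≢u ∘ sym) refl (depth-parent≡ dv)
        (bridge (v ∷ u ∷ [])
          ((adj⇒≢ pv-v ∷ pv≢u ∷ []) ∷ (adj⇒≢ vu ∷ []) ∷ [] ∷ [])
          (cons pv-v (cons vu one))
          refl
          (≤-reflexive (sym (depth-parent≡ dv)) ∷ ≤-trans (n≤1+n _) (≤-reflexive (sym dv)) ∷ ≤-refl ∷ [])))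
    where
    vu = adj-sym uv
    pv-v = adj-sym (parent-adj (≢root dv))

  edge⇒child : ∀ {u v} → adj T u v ≡ true → ChildOf u v ⊎ ChildOf v u
  edge⇒child {u} {v} uv with <-cmp (depth u) (depth v)
  ... | tri< du<dv _ _ = inj₂ (deeper-neighbour⇒child uv (≤-antisym (depth-adj (adj-sym uv)) du<dv))
  ... | tri≈ _ du≡dv _ = contradiction du≡dv (same-depth⇒¬adj uv)
  ... | tri> _ _ du>dv = inj₁ (deeper-neighbour⇒child (adj-sym uv) (≤-antisym (depth-adj uv) du>dv))

module TreeSums {n} (T : Graph n) (tree : IsTree T) (r : Fin n) where

  open import Data.Nat using (_^_)
  open import Data.Nat.Properties using (∣-∣-comm; ∣n-n∣≡0; 1+n≰n; ≤-trans; ≤-reflexive)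
  open import Data.Integer using (ℤ; +_; 0ℤ; 1ℤ; _+_; _-_; _*_; _≤_)
  import Data.Integer.Properties as ℤ
  open import Data.Integer.Tactic.RingSolver using (solve-∀)
  open import Data.Bool using (true; false; if_then_else_)
  open import Data.Fin.Properties using (_≟_)
  open import Data.Sum using (inj₁; inj₂)
  open import Data.Product using (∃; _×_; _,_)
  open import Relation.Nullary using (¬_; yes; no; contradiction)
  open import Relation.Nullary.Decidable using (¬?)
  open import Relation.Binary.PropositionalEquality using (refl; sym; trans; cong; cong₂; subst; module ≡-Reasoning)

  open IntegerSums
  open Search using (maximiser)
  open RootedTree T tree r public

  nonroot : Fin n → ℤ
  nonroot u = 𝟙 (¬? (u ≟ r))

  child : Fin n → Fin n → ℤ
  child u v = nonroot u * 𝟙 (v ≟ parent u)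

  children : Fin n → ℤ
  children v = ∑[ u < n ] child u v

  nonroot≡1-𝟙 : ∀ u → nonroot u ≡ 1ℤ - 𝟙 (u ≟ r)
  nonroot≡1-𝟙 u with u ≟ r
  ... | yes _ = refl
  ... | no _ = refl

  child-yes : ∀ {u v} → ChildOf u v → child u v ≡ 1ℤ
  child-yes {u} {v} (u≢r , pu≡v) = cong₂ _*_ (𝟙-yes (¬? (u ≟ r)) u≢r) (𝟙-yes (v ≟ parent u) (sym pu≡v))

  child-no : ∀ {u v} → ¬ ChildOf u v → child u v ≡ 0ℤ
  child-no {u} {v} ¬child with u ≟ r | v ≟ parent u
  ... | yes _   | _        = refl
  ... | no _    | no _     = refl
  ... | no u≢r  | yes v≡pu = contradiction (u≢r , sym v≡pu) ¬child

  edge-children : ∀ u v → child u v + child v u ≡ (if adj T u v then 1ℤ else 0ℤ)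
  edge-children u v with adj T u v in uv
  ... | false = cong₂ _+_ (child-no (non-edge uv)) (child-no (non-edge (trans (Graph.sym T v u) uv)))
    where
    non-edge : ∀ {a b} → adj T a b ≡ false → ¬ ChildOf a b
    non-edge ab≡false c with () ← trans (sym (child⇒adj c)) ab≡false
  ... | true with edge⇒child uv
  ...   | inj₁ c = cong₂ _+_ (child-yes c) (child-no (child-asym c))
  ...   | inj₂ c = cong₂ _+_ (child-no (child-asym c)) (child-yes c)

  edge-weight : ∀ u v s → + (if adj T u v then s else 0) ≡ (child u v + child v u) * + s
  edge-weight u v s = trans (select (adj T u v)) (cong (_* + s) (sym (edge-children u v)))
    where
    select : ∀ b → + (if b then s else 0) ≡ (if b then 1ℤ else 0ℤ) * + s
    select true = sym (ℤ.*-identityˡ (+ s))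
    select false = refl

  ∑-child : ∀ u (g : Fin n → ℤ) → ∑[ v < n ] (child u v * g v) ≡ nonroot u * g (parent u)
  ∑-child u g = begin
    ∑[ v < n ] (nonroot u * 𝟙 (v ≟ parent u) * g v)    ≡⟨ sum-cong-≗ (λ v → ℤ.*-assoc (nonroot u) (𝟙 (v ≟ parent u)) (g v)) ⟩
    ∑[ v < n ] (nonroot u * (𝟙 (v ≟ parent u) * g v))  ≡⟨ sym (*-distribˡ-sum (nonroot u) (λ v → 𝟙 (v ≟ parent u) * g v)) ⟩
    nonroot u * ∑[ v < n ] (𝟙 (v ≟ parent u) * g v)    ≡⟨ cong (nonroot u *_) (∑-pick (parent u) g) ⟩
    nonroot u * g (parent u)                           ∎
    where open ≡-Reasoning

  ∑-parent : ∀ (g : Fin n → ℤ) → ∑[ u < n ] (nonroot u * g (parent u)) ≡ ∑[ v < n ] (children v * g v)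
  ∑-parent g = begin
    ∑[ u < n ] (nonroot u * g (parent u))     ≡⟨ sum-cong-≗ (λ u → sym (∑-child u g)) ⟩
    ∑[ u < n ] ∑[ v < n ] (child u v * g v)   ≡⟨ ∑-comm (λ u v → child u v * g v) ⟩
    ∑[ v < n ] ∑[ u < n ] (child u v * g v)   ≡⟨ sum-cong-≗ (λ v → sym (*-distribʳ-sum (g v) (λ u → child u v))) ⟩
    ∑[ v < n ] (children v * g v)             ∎
    where open ≡-Reasoning

  ∑-nonroot : ∀ (f : Fin n → ℤ) → ∑[ u < n ] (nonroot u * f u) ≡ ∑[ u < n ] f u - f r
  ∑-nonroot f = begin
    ∑[ u < n ] (nonroot u * f u)
      ≡⟨ sum-cong-≗ (λ u → trans (cong (_* f u) (nonroot≡1-𝟙 u)) (distrib (𝟙 (u ≟ r)) (f u))) ⟩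
    ∑[ u < n ] (f u - 𝟙 (u ≟ r) * f u)                       ≡⟨ ∑-distrib-- f (λ u → 𝟙 (u ≟ r) * f u) ⟩
    ∑[ u < n ] f u - ∑[ u < n ] (𝟙 (u ≟ r) * f u)            ≡⟨ cong (∑[ u < n ] f u -_) (∑-pick r f) ⟩
    ∑[ u < n ] f u - f r                                     ∎
    where
    open ≡-Reasoning
    distrib : ∀ a b → (1ℤ - a) * b ≡ b - a * b
    distrib = solve-∀

  degree : ∀ u → + deg T u ≡ nonroot u + children u
  degree u = begin
    + deg T u                                              ≡⟨ +sum-allFin (λ v → if adj T u v then 1 else 0) ⟩
    ∑[ v < n ] (+ (if adj T u v then 1 else 0))            ≡⟨ sum-cong-≗ (λ v → trans (edge-weight u v 1) (ℤ.*-identityʳ _)) ⟩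
    ∑[ v < n ] (child u v + child v u)                     ≡⟨ ∑-distrib-+ (child u) (λ v → child v u) ⟩
    ∑[ v < n ] child u v + children u                      ≡⟨ cong (_+ children u) out-degree ⟩
    nonroot u + children u                                 ∎
    where
    open ≡-Reasoning
    out-degree : ∑[ v < n ] child u v ≡ nonroot u
    out-degree = trans (sum-cong-≗ (λ v → sym (ℤ.*-identityʳ (child u v))))
                       (trans (∑-child u (λ _ → 1ℤ)) (ℤ.*-identityʳ (nonroot u)))

  ∑-edges : ∀ (F : Fin n → Fin n → ℤ) →
    ∑[ u < n ] ∑[ v < n ] ((child u v + child v u) * F u v) ≡ ∑[ u < n ] (nonroot u * (F u (parent u) + F (parent u) u))
  ∑-edges F = begin
    ∑[ u < n ] ∑[ v < n ] ((child u v + child v u) * F u v)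
      ≡⟨ sum-cong-≗ (λ u → trans (sum-cong-≗ (λ v → ℤ.*-distribʳ-+ (F u v) (child u v) (child v u)))
                                 (∑-distrib-+ (λ v → child u v * F u v) (λ v → child v u * F u v))) ⟩
    ∑[ u < n ] (∑[ v < n ] (child u v * F u v) + ∑[ v < n ] (child v u * F u v))
      ≡⟨ ∑-distrib-+ (λ u → ∑[ v < n ] (child u v * F u v)) (λ u → ∑[ v < n ] (child v u * F u v)) ⟩
    ∑[ u < n ] ∑[ v < n ] (child u v * F u v) + ∑[ u < n ] ∑[ v < n ] (child v u * F u v)
      ≡⟨ cong₂ _+_ (sum-cong-≗ (λ u → ∑-child u (F u)))
                   (trans (∑-comm (λ u v → child v u * F u v)) (sum-cong-≗ (λ v → ∑-child v (λ u → F u v)))) ⟩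
    ∑[ u < n ] (nonroot u * F u (parent u)) + ∑[ u < n ] (nonroot u * F (parent u) u)
      ≡⟨ sym (∑-distrib-+ (λ u → nonroot u * F u (parent u)) (λ u → nonroot u * F (parent u) u)) ⟩
    ∑[ u < n ] (nonroot u * F u (parent u) + nonroot u * F (parent u) u)
      ≡⟨ sum-cong-≗ (λ u → sym (ℤ.*-distribˡ-+ (nonroot u) (F u (parent u)) (F (parent u) u))) ⟩
    ∑[ u < n ] (nonroot u * (F u (parent u) + F (parent u) u)) ∎
    where open ≡-Reasoning

  excess : Fin n → ℤ
  excess u = + deg T u - 1ℤ

  children≡excess+𝟙 : ∀ u → children u ≡ excess u + 𝟙 (u ≟ r)
  children≡excess+𝟙 u = begin
    children u                                   ≡⟨ cancel (nonroot u) (children u) ⟩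
    (nonroot u + children u) - nonroot u         ≡⟨ cong₂ _-_ (sym (degree u)) (nonroot≡1-𝟙 u) ⟩
    + deg T u - (1ℤ - 𝟙 (u ≟ r))                 ≡⟨ regroup (+ deg T u) (𝟙 (u ≟ r)) ⟩
    excess u + 𝟙 (u ≟ r)                         ∎
    where
    open ≡-Reasoning
    cancel : ∀ a c → c ≡ (a + c) - a
    cancel = solve-∀
    regroup : ∀ d e → d - (1ℤ - e) ≡ (d - 1ℤ) + e
    regroup = solve-∀

  ∑-nonroot≡n-1 : ∑[ u < n ] nonroot u ≡ + n - 1ℤ
  ∑-nonroot≡n-1 = begin
    ∑[ u < n ] nonroot u            ≡⟨ sum-cong-≗ (λ u → sym (ℤ.*-identityʳ (nonroot u))) ⟩
    ∑[ u < n ] (nonroot u * 1ℤ)     ≡⟨ ∑-nonroot (λ _ → 1ℤ) ⟩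
    ∑[ u < n ] 1ℤ - 1ℤ              ≡⟨ cong (_- 1ℤ) (trans (∑-const n 1ℤ) (ℤ.*-identityʳ (+ n))) ⟩
    + n - 1ℤ                        ∎
    where open ≡-Reasoning

  ∑-children≡n-1 : ∑[ u < n ] children u ≡ + n - 1ℤ
  ∑-children≡n-1 = begin
    ∑[ u < n ] children u               ≡⟨ sum-cong-≗ (λ u → sym (ℤ.*-identityʳ (children u))) ⟩
    ∑[ u < n ] (children u * 1ℤ)        ≡⟨ sym (∑-parent (λ _ → 1ℤ)) ⟩
    ∑[ u < n ] (nonroot u * 1ℤ)         ≡⟨ sum-cong-≗ (λ u → ℤ.*-identityʳ (nonroot u)) ⟩
    ∑[ u < n ] nonroot u                ≡⟨ ∑-nonroot≡n-1 ⟩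
    + n - 1ℤ                            ∎
    where open ≡-Reasoning

  ∑-excess : ∑[ u < n ] excess u ≡ + n - + 2
  ∑-excess = begin
    ∑[ u < n ] (+ deg T u - 1ℤ)                               ≡⟨ ∑-distrib-- (λ u → + deg T u) (λ _ → 1ℤ) ⟩
    ∑[ u < n ] (+ deg T u) - ∑[ u < n ] 1ℤ
      ≡⟨ cong₂ _-_ (trans (sum-cong-≗ degree) (∑-distrib-+ nonroot children)) (∑-const n 1ℤ) ⟩
    ∑[ u < n ] nonroot u + ∑[ u < n ] children u - + n * 1ℤ
      ≡⟨ cong₂ (λ a b → a + b - + n * 1ℤ) ∑-nonroot≡n-1 ∑-children≡n-1 ⟩
    (+ n - 1ℤ) + (+ n - 1ℤ) - + n * 1ℤ                        ≡⟨ simplify (+ n) ⟩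
    + n - + 2                                                 ∎
    where
    open ≡-Reasoning
    simplify : ∀ m → (m - 1ℤ) + (m - 1ℤ) - m * 1ℤ ≡ m - + 2
    simplify = solve-∀

  ∑-children*excess : ∑[ u < n ] (children u * excess u) ≡ ∑[ u < n ] (excess u * excess u) + excess r
  ∑-children*excess = begin
    ∑[ u < n ] (children u * excess u)
      ≡⟨ sum-cong-≗ (λ u → trans (cong (_* excess u) (children≡excess+𝟙 u))
                                 (ℤ.*-distribʳ-+ (excess u) (excess u) (𝟙 (u ≟ r)))) ⟩
    ∑[ u < n ] (excess u * excess u + 𝟙 (u ≟ r) * excess u)
      ≡⟨ ∑-distrib-+ (λ u → excess u * excess u) (λ u → 𝟙 (u ≟ r) * excess u) ⟩
    ∑[ u < n ] (excess u * excess u) + ∑[ u < n ] (𝟙 (u ≟ r) * excess u)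
      ≡⟨ cong (λ t → ∑[ u < n ] (excess u * excess u) + t) (∑-pick r excess) ⟩
    ∑[ u < n ] (excess u * excess u) + excess r ∎
    where open ≡-Reasoning

  sqDiff-sym : ∀ u v → sqDiff T u v ≡ sqDiff T v u
  sqDiff-sym u v = cong (_^ 2) (∣-∣-comm (deg T u) (deg T v))

  sqDiff-diag : ∀ u → sqDiff T u u ≡ 0
  sqDiff-diag u = cong (_^ 2) (∣n-n∣≡0 (deg T u))

  +sqDiff : ∀ u v → + sqDiff T u v ≡ (excess u - excess v) * (excess u - excess v)
  +sqDiff u v = trans (+∣m-n∣^2≡[m-n]^2 (deg T u) (deg T v)) (shift (+ deg T u) (+ deg T v))
    where
    shift : ∀ a b → (a - b) * (a - b) ≡ ((a - 1ℤ) - (b - 1ℤ)) * ((a - 1ℤ) - (b - 1ℤ))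
    shift = solve-∀

  δ : Fin n → ℤ
  δ u = excess u - excess (parent u)

  σ-parent : + σ T ≡ ∑[ u < n ] (nonroot u * (δ u * δ u))
  σ-parent = ℤ.*-cancelˡ-≡ (+ 2) _ _ (begin
    + 2 * + σ T
      ≡⟨ 2*sumPairs≡∑∑ n edge edge-sym edge-diag ⟩
    ∑[ u < n ] ∑[ v < n ] (+ edge u v)
      ≡⟨ sum-cong-≗ (λ u → sum-cong-≗ (weighted u)) ⟩
    ∑[ u < n ] ∑[ v < n ] ((child u v + child v u) * Δ² u v)
      ≡⟨ ∑-edges Δ² ⟩
    ∑[ u < n ] (nonroot u * (Δ² u (parent u) + Δ² (parent u) u))
      ≡⟨ sum-cong-≗ (λ u → both-directions (nonroot u) (excess u) (excess (parent u))) ⟩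
    ∑[ u < n ] (+ 2 * (nonroot u * (δ u * δ u)))
      ≡⟨ sym (*-distribˡ-sum (+ 2) (λ u → nonroot u * (δ u * δ u))) ⟩
    + 2 * ∑[ u < n ] (nonroot u * (δ u * δ u)) ∎)
    where
    open ≡-Reasoning
    edge : Fin n → Fin n → ℕ
    edge u v = if adj T u v then sqDiff T u v else 0
    edge-sym : ∀ u v → edge u v ≡ edge v u
    edge-sym u v = cong₂ (λ b s → if b then s else 0) (Graph.sym T u v) (sqDiff-sym u v)
    edge-diag : ∀ u → edge u u ≡ 0
    edge-diag u = cong (λ b → if b then sqDiff T u u else 0) (Graph.irrefl T u)
    Δ² : Fin n → Fin n → ℤ
    Δ² u v = (excess u - excess v) * (excess u - excess v)
    weighted : ∀ u v → + edge u v ≡ (child u v + child v u) * Δ² u v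
    weighted u v = trans (edge-weight u v (sqDiff T u v)) (cong ((child u v + child v u) *_) (+sqDiff u v))
    both-directions : ∀ c a b → c * ((a - b) * (a - b) + (b - a) * (b - a)) ≡ + 2 * (c * ((a - b) * (a - b)))
    both-directions = solve-∀

  σt-excess : + σt T ≡ + n * ∑[ u < n ] (excess u * excess u) - ∑[ u < n ] excess u * ∑[ u < n ] excess u
  σt-excess = ℤ.*-cancelˡ-≡ (+ 2) _ _ (begin
    + 2 * + σt T                                                          ≡⟨ 2*sumPairs≡∑∑ n (sqDiff T) sqDiff-sym sqDiff-diag ⟩
    ∑[ u < n ] ∑[ v < n ] (+ sqDiff T u v)                                 ≡⟨ sum-cong-≗ (λ u → sum-cong-≗ (+sqDiff u)) ⟩
    ∑[ u < n ] ∑[ v < n ] ((excess u - excess v) * (excess u - excess v))  ≡⟨ ∑∑-square-differences n excess ⟩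
    + 2 * (+ n * ∑[ u < n ] (excess u * excess u) - ∑[ u < n ] excess u * ∑[ u < n ] excess u) ∎)
    where open ≡-Reasoning

  E : ℤ
  E = ∑[ u < n ] (nonroot u * (δ u * δ u + δ u))

  W : ℤ
  W = ∑[ u < n ] (excess u * (excess r - excess u))

  E-expansion : E ≡ + σ T + (∑[ u < n ] excess u - excess r) - (∑[ u < n ] (excess u * excess u) + excess r)
  E-expansion = begin
    ∑[ u < n ] (nonroot u * (δ u * δ u + δ u))
      ≡⟨ sum-cong-≗ (λ u → split (nonroot u) (excess u) (excess (parent u))) ⟩
    ∑[ u < n ] (nonroot u * (δ u * δ u) + nonroot u * excess u - nonroot u * excess (parent u))
      ≡⟨ ∑-distrib-- (λ u → nonroot u * (δ u * δ u) + nonroot u * excess u) (λ u → nonroot u * excess (parent u)) ⟩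
    ∑[ u < n ] (nonroot u * (δ u * δ u) + nonroot u * excess u) - ∑[ u < n ] (nonroot u * excess (parent u))
      ≡⟨ cong₂ _-_ (∑-distrib-+ (λ u → nonroot u * (δ u * δ u)) (λ u → nonroot u * excess u)) (∑-parent excess) ⟩
    ∑[ u < n ] (nonroot u * (δ u * δ u)) + ∑[ u < n ] (nonroot u * excess u) - ∑[ u < n ] (children u * excess u)
      ≡⟨ cong₂ _-_ (cong₂ _+_ (sym σ-parent) (∑-nonroot excess)) ∑-children*excess ⟩
    + σ T + (∑[ u < n ] excess u - excess r) - (∑[ u < n ] (excess u * excess u) + excess r) ∎
    where
    open ≡-Reasoning
    split : ∀ c a b → c * ((a - b) * (a - b) + (a - b)) ≡ c * ((a - b) * (a - b)) + c * a - c * b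
    split = solve-∀

  W-expansion : W ≡ ∑[ u < n ] excess u * excess r - ∑[ u < n ] (excess u * excess u)
  W-expansion = begin
    ∑[ u < n ] (excess u * (excess r - excess u))            ≡⟨ sum-cong-≗ (λ u → distrib (excess u) (excess r)) ⟩
    ∑[ u < n ] (excess u * excess r - excess u * excess u)
      ≡⟨ ∑-distrib-- (λ u → excess u * excess r) (λ u → excess u * excess u) ⟩
    ∑[ u < n ] (excess u * excess r) - ∑[ u < n ] (excess u * excess u)
      ≡⟨ cong (_- ∑[ u < n ] (excess u * excess u)) (sym (*-distribʳ-sum (excess r) excess)) ⟩
    ∑[ u < n ] excess u * excess r - ∑[ u < n ] (excess u * excess u) ∎
    where
    open ≡-Reasoning
    distrib : ∀ a b → a * (b - a) ≡ a * b - a * a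
    distrib = solve-∀

  gap-identity : (+ n - + 2) * + σ T - + σt T ≡ (+ n - + 2) * E + + 2 * W
  gap-identity = begin
    (+ n - + 2) * + σ T - + σt T                                   ≡⟨ cong₂ (λ s t → (+ n - + 2) * s - t) σ≡ σt-excess ⟩
    (+ n - + 2) * (E - (S - m) + (Q + m)) - (+ n * Q - S * S)
      ≡⟨ cong (λ s → (+ n - + 2) * (E - (s - m) + (Q + m)) - (+ n * Q - s * s)) ∑-excess ⟩
    (+ n - + 2) * (E - ((+ n - + 2) - m) + (Q + m)) - (+ n * Q - (+ n - + 2) * (+ n - + 2))
      ≡⟨ collect (+ n) E m Q ⟩
    (+ n - + 2) * E + + 2 * ((+ n - + 2) * m - Q)                  ≡⟨ cong (λ s → (+ n - + 2) * E + + 2 * (s * m - Q)) (sym ∑-excess) ⟩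
    (+ n - + 2) * E + + 2 * (S * m - Q)                            ≡⟨ cong (λ w → (+ n - + 2) * E + + 2 * w) (sym W-expansion) ⟩
    (+ n - + 2) * E + + 2 * W                                      ∎
    where
    open ≡-Reasoning
    S = ∑[ u < n ] excess u
    Q = ∑[ u < n ] (excess u * excess u)
    m = excess r
    undo : ∀ s a b → s ≡ s + a - b - a + b
    undo = solve-∀
    σ≡ : + σ T ≡ E - (S - m) + (Q + m)
    σ≡ = trans (undo (+ σ T) (S - m) (Q + m)) (cong (λ e → e - (S - m) + (Q + m)) (sym E-expansion))
    collect : ∀ N E m Q → (N - + 2) * (E - ((N - + 2) - m) + (Q + m)) - (N * Q - (N - + 2) * (N - + 2))
                          ≡ (N - + 2) * E + + 2 * ((N - + 2) * m - Q)
    collect = solve-∀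

  child-nonneg : ∀ u v → 0ℤ ≤ child u v
  child-nonneg u v = *-nonneg (𝟙-nonneg (¬? (u ≟ r))) (𝟙-nonneg (v ≟ parent u))

  children≡excess : ∀ {u} → u ≢ r → children u ≡ excess u
  children≡excess {u} u≢r =
    trans (children≡excess+𝟙 u) (trans (cong (λ t → excess u + t) (𝟙-no (u ≟ r) u≢r)) (ℤ.+-identityʳ (excess u)))

  excess-nonroot-nonneg : ∀ {u} → u ≢ r → 0ℤ ≤ excess u
  excess-nonroot-nonneg {u} u≢r = subst (0ℤ ≤_) (children≡excess u≢r) (∑-nonneg (λ c → child-nonneg c u))

  E-term-nonneg : ∀ u → 0ℤ ≤ nonroot u * (δ u * δ u + δ u)
  E-term-nonneg u = *-nonneg (𝟙-nonneg (¬? (u ≟ r))) (square+self-nonneg (δ u))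

  E-nonneg : 0ℤ ≤ E
  E-nonneg = ∑-nonneg E-term-nonneg

  deepest-leaf : ∀ {u₀} → u₀ ≢ r → ∃ λ w → w ≢ r × excess w ≡ 0ℤ
  deepest-leaf {u₀} u₀≢r with w , w-max ← maximiser depth u₀ = w , w≢r , excess-w
    where
    w≢r : w ≢ r
    w≢r refl = u₀≢r (depth≡0⇒root (Data.Nat.Properties.n≤0⇒n≡0 (subst (depth u₀ Data.Nat.≤_) depth-root (w-max u₀))))
    childless : children w ≡ 0ℤ
    childless = trans (sum-cong-≗ {n} {λ c → child c w} (λ c → child-no (no-child c))) (∑-zero n)
      where
      no-child : ∀ c → ¬ ChildOf c w
      no-child c (c≢r , refl) = 1+n≰n (≤-trans (≤-reflexive (depth-parent c≢r)) (w-max c))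
    excess-w : excess w ≡ 0ℤ
    excess-w = trans (sym (children≡excess w≢r)) childless

  parent-excess-pos : ∀ {u} → u ≢ r → parent u ≢ r → 1ℤ ≤ excess (parent u)
  parent-excess-pos {u} u≢r pu≢r = subst (1ℤ ≤_) (children≡excess pu≢r)
    (subst (_≤ children (parent u)) (child-yes (u≢r , refl)) (term≤∑ (λ c → child-nonneg c (parent u)) u))

module MaxDegreeRoot {k} (T : Graph (suc (suc k))) (tree : IsTree T) (r : Fin (suc (suc k)))
                     (r-max : ∀ u → deg T u Data.Nat.≤ deg T r) where

  import Data.Nat as ℕ
  import Data.Nat.Properties as ℕ
  open import Data.Nat using (z≤n)
  open import Data.Integer using (ℤ; +_; 0ℤ; 1ℤ; _+_; _-_; -_; _*_; _≤_; +≤+)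
  import Data.Integer.Properties as ℤ
  open import Data.Integer.Tactic.RingSolver using (solve-∀)
  open import Data.Fin.Properties using (_≟_)
  open import Data.Product using (∃; _,_; proj₁; proj₂)
  open import Data.Sum using (_⊎_; inj₁; inj₂; [_,_]′)
  open import Function using (id)
  open import Relation.Nullary using (Dec; yes; no; contradiction)
  open import Relation.Nullary.Decidable using (¬?)
  open import Relation.Binary.PropositionalEquality using (refl; sym; trans; cong; subst; module ≡-Reasoning)

  open IntegerSums
  open TreeSums T tree r

  another-vertex : ∃ λ u → u ≢ r
  another-vertex = other r
    where
    other : (v : Fin (suc (suc k))) → ∃ λ u → u ≢ v
    other zero = suc zero , λ ()
    other (suc _) = zero , λ ()

  excess≤root : ∀ u → excess u ≤ excess r
  excess≤root u = ℤ.+-monoˡ-≤ (- 1ℤ) (+≤+ (r-max u))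

  excess-nonneg : ∀ u → 0ℤ ≤ excess u
  excess-nonneg u with u ≟ r
  ... | no u≢r = excess-nonroot-nonneg u≢r
  ... | yes refl with u₀ , u₀≢r ← another-vertex = ℤ.≤-trans (excess-nonroot-nonneg u₀≢r) (excess≤root u₀)

  W-term-nonneg : ∀ u → 0ℤ ≤ excess u * (excess r - excess u)
  W-term-nonneg u = *-nonneg (excess-nonneg u) (ℤ.i≤j⇒0≤j-i (excess≤root u))

  W-nonneg : 0ℤ ≤ W
  W-nonneg = ∑-nonneg W-term-nonneg

  -- Here + suc (suc k) - + 2 computes to + k.
  gap : + k * + σ T - + σt T ≡ + k * E + + 2 * W
  gap = gap-identity

  kE-nonneg : 0ℤ ≤ + k * E
  kE-nonneg = *-nonneg (ℤ.nonNegative⁻¹ (+ k)) E-nonneg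

  2W-nonneg : 0ℤ ≤ + 2 * W
  2W-nonneg = *-nonneg (ℤ.nonNegative⁻¹ (+ 2)) W-nonneg

  gap-nonneg : 0ℤ ≤ + k * E + + 2 * W
  gap-nonneg = ℤ.+-mono-≤ kE-nonneg 2W-nonneg

  σt≤kσ : σt T ℕ.≤ k ℕ.* σ T
  σt≤kσ = ℤ.drop‿+≤+ (subst (+ σt T ≤_) (sym (ℤ.pos-* k (σ T))) (ℤ.0≤i-j⇒j≤i (subst (0ℤ ≤_) (sym gap) gap-nonneg)))

  gap≡0 : σt T ≡ k ℕ.* σ T → + k * E + + 2 * W ≡ 0ℤ
  gap≡0 eq = trans (sym gap) (trans (cong (λ t → + k * + σ T - t) (trans (cong +_ eq) (ℤ.pos-* k (σ T))))
                                    (ℤ.+-inverseʳ (+ k * + σ T)))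

  leaf-parent-excess : E ≡ 0ℤ → ∀ {w} → w ≢ r → excess w ≡ 0ℤ → excess (parent w) * (excess (parent w) - 1ℤ) ≡ 0ℤ
  leaf-parent-excess E≡0 {w} w≢r excess-w = begin
    x * (x - 1ℤ)                        ≡⟨ factor x ⟩
    (0ℤ - x) * (0ℤ - x) + (0ℤ - x)      ≡⟨ cong (λ e → (e - x) * (e - x) + (e - x)) (sym excess-w) ⟩
    δ w * δ w + δ w                     ≡⟨ sym (ℤ.*-identityˡ (δ w * δ w + δ w)) ⟩
    1ℤ * (δ w * δ w + δ w)              ≡⟨ cong (_* (δ w * δ w + δ w)) (sym (𝟙-yes (¬? (w ≟ r)) w≢r)) ⟩
    nonroot w * (δ w * δ w + δ w)       ≡⟨ ∑≡0⇒≡0 E-term-nonneg E≡0 w ⟩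
    0ℤ                                  ∎
    where
    open ≡-Reasoning
    x = excess (parent w)
    factor : ∀ x → x * (x - 1ℤ) ≡ (0ℤ - x) * (0ℤ - x) + (0ℤ - x)
    factor = solve-∀

  k≡0⊎E≡0 : σt T ≡ k ℕ.* σ T → + k ≡ 0ℤ ⊎ E ≡ 0ℤ
  k≡0⊎E≡0 eq = ℤ.i*j≡0⇒i≡0∨j≡0 (+ k) (proj₁ (+-nonneg-≡0 kE-nonneg 2W-nonneg (gap≡0 eq)))

  W≡0 : σt T ≡ k ℕ.* σ T → W ≡ 0ℤ
  W≡0 eq = [ (λ ()) , id ]′ (ℤ.i*j≡0⇒i≡0∨j≡0 (+ 2) (proj₂ (+-nonneg-≡0 kE-nonneg 2W-nonneg (gap≡0 eq))))

  root-excess≤1-via-leaf : W ≡ 0ℤ → E ≡ 0ℤ → excess r ≤ 1ℤ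
  root-excess≤1-via-leaf W≡0 E≡0 =
    from-parent (parent w ≟ r) (ℤ.i*j≡0⇒i≡0∨j≡0 (excess (parent w)) (leaf-parent-excess E≡0 w≢r excess-w))
    where
    leaf = deepest-leaf (proj₂ another-vertex)
    w = proj₁ leaf
    w≢r = proj₁ (proj₂ leaf)
    excess-w = proj₂ (proj₂ leaf)
    from-parent : Dec (parent w ≡ r) → excess (parent w) ≡ 0ℤ ⊎ excess (parent w) - 1ℤ ≡ 0ℤ → excess r ≤ 1ℤ
    from-parent (yes q≡r) (inj₁ xq≡0) = ℤ.≤-trans (ℤ.≤-reflexive (trans (cong excess (sym q≡r)) xq≡0)) (+≤+ z≤n)
    from-parent (no q≢r) (inj₁ xq≡0) =
      contradiction (ℤ.≤-trans (parent-excess-pos w≢r q≢r) (ℤ.≤-reflexive xq≡0)) λ { (+≤+ ()) }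
    from-parent _ (inj₂ xq-1≡0) = ℤ.≤-reflexive (ℤ.i-j≡0⇒i≡j (excess r) 1ℤ m-1≡0)
      where
      xq≡1 = ℤ.i-j≡0⇒i≡j (excess (parent w)) 1ℤ xq-1≡0
      m-1≡0 : excess r - 1ℤ ≡ 0ℤ
      m-1≡0 = trans (sym (ℤ.*-identityˡ (excess r - 1ℤ)))
                    (trans (cong (λ x → x * (excess r - x)) (sym xq≡1)) (∑≡0⇒≡0 W-term-nonneg W≡0 (parent w)))

  root-excess≤1 : σt T ≡ k ℕ.* σ T → excess r ≤ 1ℤ
  root-excess≤1 eq = [ small-tree , root-excess≤1-via-leaf (W≡0 eq) ]′ (k≡0⊎E≡0 eq)
    where
    small-tree : + k ≡ 0ℤ → excess r ≤ 1ℤ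
    small-tree k≡0 = ℤ.≤-trans (ℤ.≤-reflexive (∑≡0⇒≡0 excess-nonneg (trans ∑-excess k≡0) r)) (+≤+ z≤n)

  degree≤2 : σt T ≡ k ℕ.* σ T → ∀ u → deg T u ℕ.≤ 2
  degree≤2 eq u = ℕ.≤-trans (r-max u) (ℤ.drop‿+≤+ deg-r≤2)
    where
    restore : ∀ d → d ≡ d - 1ℤ + 1ℤ
    restore = solve-∀
    deg-r≤2 : + deg T r ≤ + 2
    deg-r≤2 = ℤ.≤-trans (ℤ.≤-reflexive (restore (+ deg T r))) (ℤ.+-monoˡ-≤ 1ℤ (root-excess≤1 eq))

  leaf : ∃ λ ℓ → deg T ℓ ≡ 1
  leaf = let w , _ , excess-w = deepest-leaf (proj₂ another-vertex) in
         w , ℤ.+-injective (ℤ.i-j≡0⇒i≡j (+ deg T w) 1ℤ excess-w)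

module PathLike {n} (T : Graph n) (tree : IsTree T) (ℓ : Fin n)
                (leaf : deg T ℓ ≡ 1) (deg≤2 : ∀ u → deg T u Data.Nat.≤ 2) where

  open import Data.Nat using (∣_-_∣)
  open import Data.Nat.Properties using (∣-∣-comm)
  open import Data.Integer using (ℤ; +_; 1ℤ; _+_; _-_; -_; _≤_; +≤+)
  import Data.Integer.Properties as ℤ
  open import Data.Bool using (true)
  open import Data.Bool.Properties using (⇔→≡)
  open import Data.Fin using (toℕ; fromℕ<)
  open import Data.Fin.Properties using (_≟_; toℕ-fromℕ<)
  open import Data.Product using (_,_; proj₁; proj₂)
  open import Data.Sum using (_⊎_; inj₁; inj₂)
  open import Function.Bundles using (_⇔_; mk↔ₛ′; mk⇔)
  open import Relation.Nullary using (yes; no; contradiction)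
  open import Relation.Binary.PropositionalEquality using (refl; sym; trans; cong; cong₂; subst)

  open IntegerSums
  open Search using (injective⇒surjective)
  open TreeSums T tree ℓ

  children≤1 : ∀ c → children c ≤ 1ℤ
  children≤1 c with c ≟ ℓ
  ... | yes refl = ℤ.≤-reflexive (trans (children≡excess+𝟙 c) (cong₂ (λ d i → + d - 1ℤ + i) leaf (𝟙-yes (c ≟ c) refl)))
  ... | no c≢ℓ = subst (_≤ 1ℤ) (sym (children≡excess c≢ℓ)) (ℤ.+-monoˡ-≤ (- 1ℤ) (+≤+ (deg≤2 c)))

  only-child : ∀ {u v c} → ChildOf u c → ChildOf v c → u ≡ v
  only-child {u} {v} {c} u→c v→c with u ≟ v
  ... | yes u≡v = u≡v
  ... | no u≢v = contradiction (ℤ.≤-trans (subst (_≤ children c) (cong₂ _+_ (child-yes u→c) (child-yes v→c))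
                                                   (two-terms≤∑ (λ x → child-nonneg x c) u≢v))
                                         (children≤1 c))
                               λ { (+≤+ (Data.Nat.s≤s ())) }

  depth-injective : ∀ k {u v} → depth u ≡ k → depth v ≡ k → u ≡ v
  depth-injective zero du dv = trans (depth≡0⇒root du) (sym (depth≡0⇒root dv))
  depth-injective (suc k) du dv =
    only-child (≢root du , refl) (≢root dv , sym (depth-injective k (depth-parent≡ du) (depth-parent≡ dv)))

  ∣suc-∣≡1 : ∀ a → ∣ suc a - a ∣ ≡ 1
  ∣suc-∣≡1 zero = refl
  ∣suc-∣≡1 (suc a) = ∣suc-∣≡1 a

  ∣-∣≡1⇒successive : ∀ a b → ∣ a - b ∣ ≡ 1 → a ≡ suc b ⊎ b ≡ suc a
  ∣-∣≡1⇒successive zero (suc zero) _ = inj₂ refl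
  ∣-∣≡1⇒successive (suc zero) zero _ = inj₁ refl
  ∣-∣≡1⇒successive (suc a) (suc b) eq = Data.Sum.map (cong suc) (cong suc) (∣-∣≡1⇒successive a b eq)

  isOne⇒≡1 : ∀ d → isOne d ≡ true → d ≡ 1
  isOne⇒≡1 1 _ = refl
  isOne⇒≡1 zero ()
  isOne⇒≡1 (suc (suc d)) ()

  adj⇔successive-depths : ∀ u v → adj T u v ≡ true ⇔ isOne ∣ depth u - depth v ∣ ≡ true
  adj⇔successive-depths u v = mk⇔ to from
    where
    up : ∀ {a} → a ≢ ℓ → ∣ depth a - depth (parent a) ∣ ≡ 1
    up {a} a≢ℓ = trans (cong (λ d → ∣ d - depth (parent a) ∣) (sym (depth-parent a≢ℓ))) (∣suc-∣≡1 (depth (parent a)))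
    to : adj T u v ≡ true → isOne ∣ depth u - depth v ∣ ≡ true
    to uv with edge⇒child uv
    ... | inj₁ (u≢ℓ , refl) = cong isOne (up u≢ℓ)
    ... | inj₂ (v≢ℓ , refl) = cong isOne (trans (∣-∣-comm (depth (parent v)) (depth v)) (up v≢ℓ))
    below : ∀ {a b} → depth a ≡ suc (depth b) → adj T a b ≡ true
    below {a} {b} da = subst (λ c → adj T a c ≡ true) (depth-injective (depth b) (depth-parent≡ da) refl) (parent-adj (≢root da))
    from : isOne ∣ depth u - depth v ∣ ≡ true → adj T u v ≡ true
    from successive with ∣-∣≡1⇒successive (depth u) (depth v) (isOne⇒≡1 _ successive)
    ... | inj₁ du = below du
    ... | inj₂ dv = adj-sym (below dv)

  index : Fin n → Fin n
  index u = fromℕ< (depth<n u)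

  toℕ-index : ∀ u → toℕ (index u) ≡ depth u
  toℕ-index u = toℕ-fromℕ< (depth<n u)

  index-injective : ∀ {u v} → index u ≡ index v → u ≡ v
  index-injective {u} {v} eq = depth-injective (depth u) refl (trans (sym (toℕ-index v)) (trans (cong toℕ (sym eq)) (toℕ-index u)))

  ≅path : T ≅ P n
  ≅path = mk↔ₛ′ index unindex (λ i → proj₂ (onto i)) (λ u → index-injective (proj₂ (onto (index u))))
        , λ u v → trans (⇔→≡ (adj⇔successive-depths u v))
                        (cong₂ (λ a b → isOne ∣ a - b ∣) (sym (toℕ-index u)) (sym (toℕ-index v)))
    where
    onto = injective⇒surjective index index-injective
    unindex = λ i → proj₁ (onto i)

open import Data.Nat using (_≤_; _*_; _∸_; z≤n)
open import Data.Product using (_×_; _,_; proj₁; proj₂)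
open import Relation.Binary.PropositionalEquality using (refl)
open import Function using (id)
open import Function.Bundles using (mk↔ₛ′)
open Search using (maximiser)

theorem2 : ∀ n (T : Graph n) → IsTree T →
    (σt T ≤ (n ∸ 2) * σ T) × (σt T ≡ (n ∸ 2) * σ T → T ≅ P n)
theorem2 zero T _ = z≤n , λ _ → mk↔ₛ′ id id (λ ()) (λ ()) , λ ()
theorem2 (suc zero) T _ =
  z≤n , λ _ → mk↔ₛ′ id id (λ { zero → refl }) (λ { zero → refl }) , λ { zero zero → Graph.irrefl T zero }
theorem2 (suc (suc k)) T tree = σt≤kσ , λ equality → PathLike.≅path T tree ℓ deg-ℓ≡1 (degree≤2 equality)
  where
  open MaxDegreeRoot T tree (proj₁ (maximiser (deg T) zero)) (proj₂ (maximiser (deg T) zero))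
  ℓ = proj₁ leaf
  deg-ℓ≡1 = proj₂ leaf
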